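{- Every (finite, nonempty, simple) planar graph has a vertex of degree at most $5$ that has at most two neighbors of degree at least $12$. -}

module Defs where

open import Data.Nat using (ℕ; zero; suc; _+_; _*_; _≤_; _≤ᵇ_; _≡ᵇ_)
open import Data.Bool using (Bool; true; false; _∧_; _∨_; if_then_else_)
open import Data.Fin using (Fin; toℕ; _≟_)
open import Data.Product using (_×_; _,_; ∃-syntax)
open import Relation.Binary.PropositionalEquality using (_≡_)
open import Relation.Nullary.Decidable using (⌊_⌋)

count : ∀ {n} → (Fin n → Bool) → ℕ
count {zero}  p = 0
count {suc n} p = (if p Data.Fin.zero then 1 else 0) + count {n} (λ i → p (Data.Fin.suc i))

anyFin : ∀ {n} → (Fin n → Bool) → Bool
anyFin {zero}  p = false
anyFin {suc n} p = p Data.Fin.zero ∨ anyFin {n} (λ i → p (Data.Fin.suc i))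

allFin : ∀ {n} → (Fin n → Bool) → Bool
allFin {zero}  p = true
allFin {suc n} p = p Data.Fin.zero ∧ allFin {n} (λ i → p (Data.Fin.suc i))

allBelow : ℕ → (ℕ → Bool) → Bool
allBelow zero    p = true
allBelow (suc m) p = allBelow m p ∧ p m

sumFin : ∀ {n} → (Fin n → ℕ) → ℕ
sumFin {zero}  f = 0
sumFin {suc n} f = f Data.Fin.zero + sumFin {n} (λ i → f (Data.Fin.suc i))

iter : ∀ {A : Set} → (A → A) → ℕ → A → A
iter f zero    x = x
iter f (suc k) x = f (iter f k x)

record SimpleGraph (n : ℕ) : Set where
  field
    adj    : Fin n → Fin n → Bool
    sym    : ∀ u v → adj u v ≡ adj v u
    irrefl : ∀ v → adj v v ≡ false
open SimpleGraph public

module _ {n : ℕ} (G : SimpleGraph n) where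

  degree : Fin n → ℕ
  degree v = count (adj G v)

  edgeCount : ℕ
  edgeCount = sumFin (λ u → count (λ v → (suc (toℕ u) ≤ᵇ toℕ v) ∧ adj G u v))

  isolatedCount : ℕ
  isolatedCount = count (λ v → degree v ≡ᵇ 0)

  reach : ℕ → Fin n → Fin n → Bool
  reach zero    u w = ⌊ u ≟ w ⌋
  reach (suc k) u w = reach k u w ∨ anyFin (λ x → reach k u x ∧ adj G x w)

  -- number of connected components: vertices that are the least
  -- (w.r.t. the index order) vertex of their component
  componentCount : ℕ
  componentCount =
    count (λ v → allFin (λ u → if reach n v u then toℕ v ≤ᵇ toℕ u else true))

  -- Rotation systems (combinatorial embeddings).
  -- rot u is a cyclic permutation of the neighbourhood N(u).

  record IsRotationSystem (rot : Fin n → Fin n → Fin n) : Set where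
    field
      closed : ∀ u v → adj G u v ≡ true → adj G u (rot u v) ≡ true
      inj    : ∀ u v w → adj G u v ≡ true → adj G u w ≡ true →
               rot u v ≡ rot u w → v ≡ w
      cyclic : ∀ u v w → adj G u v ≡ true → adj G u w ≡ true →
               ∃[ k ] iter (rot u) k v ≡ w

  -- darts are ordered pairs (u , v) with adj G u v ≡ true;
  -- face permutation φ (u , v) = (v , rot v u)
  module Faces (rot : Fin n → Fin n → Fin n) where

    φ : Fin n × Fin n → Fin n × Fin n
    φ (u , v) = (v , rot v u)

    code : Fin n × Fin n → ℕ
    code (u , v) = toℕ u * n + toℕ v

    -- dart d is the code-least dart in its φ-orbit (orbits have length ≤ n*n)
    isFaceRep : Fin n × Fin n → Bool
    isFaceRep d = allBelow (n * n) (λ k → code d ≤ᵇ code (iter φ k d))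

    -- number of faces = number of φ-orbits on darts
    faceCount : ℕ
    faceCount = sumFin (λ u → count (λ v → adj G u v ∧ isFaceRep (u , v)))

  -- The embedding given by rot has every component of genus 0, i.e.
  -- Euler's formula V - E + F = 2C - I holds (written without subtraction).
  -- (Each nontrivial component satisfies V_c - E_c + F_c = 2 - 2 g_c, an
  -- isolated vertex contributes V = 1, F = 0.)
  IsPlanarRotation : (Fin n → Fin n → Fin n) → Set
  IsPlanarRotation rot =
    n + Faces.faceCount rot + isolatedCount ≡ 2 * componentCount + edgeCount

  -- A finite simple graph is planar iff it admits a genus-0 rotation system
  Planar : Set
  Planar = ∃[ rot ] (IsRotationSystem rot × IsPlanarRotation rot)

-- Suppose every vertex of degree at most 5 has three neighbours of degree at least 12; then the
-- minimum degree is at least 3. Give every dart 12 units: 8 (on a triangle) or 6 (otherwise) to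
-- the face it bounds, and the remaining 4 or 6 to its head vertex. Every face then holds at least
-- 24, so Euler's formula n + F ≥ E + 2 leaves less than 24 n to the vertices. Discharging: a
-- vertex of degree d ≥ 12 passes 2 units through each of its corners to the light (degree ≤ 5)
-- ends of that corner and keeps at least 4 d - 2 d ≥ 24; a vertex of degree 6 … 11 keeps 4 d ≥ 24;
-- a light vertex with k ≥ 3 heavy neighbours collects at least 2 + 3 [a heavy] + 3 [b heavy] at
-- each of its corners (a , v , b), hence at least 2 d + 6 k ≥ 24. So the vertices hold at least
-- 24 n, a contradiction.

module Submission where

open import Defs renaming (sym to adj-sym)
open import Data.Nat using (ℕ; zero; suc; _+_; _*_; _∸_; _≤_; _<_; _≤ᵇ_; _≡ᵇ_; z≤n; s≤s; s≤s⁻¹; _≤?_)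
open import Data.Nat.Properties hiding (_≟_)
open import Data.Nat.DivMod using (_%_; _/_; m≡m%n+[m/n]*n; m%n<n)
open import Data.Fin using (Fin; zero; suc; toℕ; _≟_; combine)
import Data.Fin.Properties as Finₚ
open import Data.Bool using (Bool; true; false; _∧_; not; if_then_else_; T)
open import Data.Product using (_×_; _,_; ∃-syntax; proj₁; proj₂; uncurry)
open import Data.Product.Properties using (,-injective)
open import Data.Sum using (inj₁; inj₂)
open import Relation.Binary.PropositionalEquality
open import Relation.Binary.Definitions using (DecidableEquality; tri<; tri≈; tri>)
open import Relation.Nullary using (Dec; does; yes; no; ¬_; contradiction)
open import Algebra.Properties.CommutativeSemigroup +-commutativeSemigroup
  using () renaming (interchange to +-interchange)
open import Function using (_∘_)
open import Relation.Nullary.Decidable using (_×-dec_; dec-true; dec-false; map′; from-yes)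

𝟙 : Bool → ℕ
𝟙 b = if b then 1 else 0

infixr 8 _⊙_
_⊙_ : Bool → ℕ → ℕ
b ⊙ x = if b then x else 0

𝟙≤1 : ∀ b → 𝟙 b ≤ 1
𝟙≤1 true  = s≤s z≤n
𝟙≤1 false = z≤n

𝟙-positive : ∀ {b} → 1 ≤ 𝟙 b → b ≡ true
𝟙-positive {true} _ = refl

if-same : ∀ {A : Set} b (x : A) → (if b then x else x) ≡ x
if-same true  x = refl
if-same false x = refl

⊙-zeroʳ : ∀ b → b ⊙ 0 ≡ 0
⊙-zeroʳ true  = refl
⊙-zeroʳ false = refl

⊙-comm : ∀ a b x → a ⊙ b ⊙ x ≡ b ⊙ a ⊙ x
⊙-comm true  true  x = refl
⊙-comm true  false x = refl
⊙-comm false true  x = refl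
⊙-comm false false x = refl

⊙-distrib-+ : ∀ a x y → a ⊙ (x + y) ≡ a ⊙ x + a ⊙ y
⊙-distrib-+ true  x y = refl
⊙-distrib-+ false x y = refl

⊙-𝟙-∧ : ∀ b c q k → b ⊙ (k * 𝟙 (c ∧ q)) ≡ q ⊙ c ⊙ b ⊙ k
⊙-𝟙-∧ true  true  true  k = *-identityʳ k
⊙-𝟙-∧ true  true  false k = *-zeroʳ k
⊙-𝟙-∧ true  false q     k = trans (*-zeroʳ k) (sym (⊙-zeroʳ q))
⊙-𝟙-∧ false c     q     k = sym (trans (cong (q ⊙_) (⊙-zeroʳ c)) (⊙-zeroʳ q))

⊙-monoʳ : ∀ b {x y} → x ≤ y → b ⊙ x ≤ b ⊙ y
⊙-monoʳ true  x≤y = x≤y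
⊙-monoʳ false _   = z≤n

∧-true : ∀ {x y} → (x ∧ y) ≡ true → x ≡ true × y ≡ true
∧-true {true} {true} _ = refl , refl

≤ᵇ-sound : ∀ {m n} → (m ≤ᵇ n) ≡ true → m ≤ n
≤ᵇ-sound {m} {n} e = ≤ᵇ⇒≤ m n (subst T (sym e) _)

≤ᵇ-complete : ∀ {m n} → m ≤ n → (m ≤ᵇ n) ≡ true
≤ᵇ-complete m≤n = dec-true (_ ≤? _) m≤n

≤ᵇ-false-sound : ∀ {m n} → (m ≤ᵇ n) ≡ false → n < m
≤ᵇ-false-sound e = ≰⇒> (λ m≤n → contradiction (trans (sym (≤ᵇ-complete m≤n)) e) λ ())

≤ᵇ-false-complete : ∀ {m n} → n < m → (m ≤ᵇ n) ≡ false
≤ᵇ-false-complete n<m = dec-false (_ ≤? _) (<⇒≱ n<m)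

does-sound : ∀ {A : Set} (a? : Dec A) → does a? ≡ true → A
does-sound (yes a) _ = a

does-sound-¬ : ∀ {A : Set} (a? : Dec A) → does a? ≡ false → ¬ A
does-sound-¬ (no ¬a) _ = ¬a

sumFin-cong : ∀ {n} {f g : Fin n → ℕ} → (∀ i → f i ≡ g i) → sumFin f ≡ sumFin g
sumFin-cong {zero}  e = refl
sumFin-cong {suc n} e = cong₂ _+_ (e zero) (sumFin-cong (e ∘ suc))

sumFin-mono : ∀ {n} {f g : Fin n → ℕ} → (∀ i → f i ≤ g i) → sumFin f ≤ sumFin g
sumFin-mono {zero}  e = z≤n
sumFin-mono {suc n} e = +-mono-≤ (e zero) (sumFin-mono (e ∘ suc))

sumFin-zero : ∀ {n} {f : Fin n → ℕ} → (∀ i → f i ≡ 0) → sumFin f ≡ 0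
sumFin-zero {zero}  e = refl
sumFin-zero {suc n} e = cong₂ _+_ (e zero) (sumFin-zero (e ∘ suc))

sumFin-const : ∀ {n} c → sumFin {n} (λ _ → c) ≡ n * c
sumFin-const {zero}  c = refl
sumFin-const {suc n} c = cong (c +_) (sumFin-const {n} c)

sumFin-distrib-+ : ∀ {n} (f g : Fin n → ℕ) → sumFin (λ i → f i + g i) ≡ sumFin f + sumFin g
sumFin-distrib-+ {zero}  f g = refl
sumFin-distrib-+ {suc n} f g =
  trans (cong (f zero + g zero +_) (sumFin-distrib-+ (f ∘ suc) (g ∘ suc)))
        (+-interchange (f zero) (g zero) _ _)

sumFin-*ˡ : ∀ {n} c (f : Fin n → ℕ) → sumFin (λ i → c * f i) ≡ c * sumFin f
sumFin-*ˡ {zero}  c f = sym (*-zeroʳ c)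
sumFin-*ˡ {suc n} c f = trans (cong (c * f zero +_) (sumFin-*ˡ c (f ∘ suc))) (sym (*-distribˡ-+ c _ _))

sumFin-comm : ∀ {m n} (f : Fin m → Fin n → ℕ) →
              sumFin (λ i → sumFin (f i)) ≡ sumFin (λ j → sumFin (λ i → f i j))
sumFin-comm {zero}  {n} f = sym (sumFin-zero {n} (λ _ → refl))
sumFin-comm {suc m} {n} f =
  trans (cong (sumFin (f zero) +_) (sumFin-comm (f ∘ suc)))
        (sym (sumFin-distrib-+ (f zero) (λ j → sumFin (λ i → f (suc i) j))))

≤-sumFin : ∀ {n} (f : Fin n → ℕ) j → f j ≤ sumFin f
≤-sumFin f zero    = m≤m+n _ _
≤-sumFin f (suc j) = ≤-trans (≤-sumFin (f ∘ suc) j) (m≤n+m _ _)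

sumFin-δ : ∀ {n} (c : Fin n → ℕ) j → sumFin (λ i → does (i ≟ j) ⊙ c i) ≡ c j
sumFin-δ {suc n} c zero    = trans (cong (c zero +_) (sumFin-zero {n} λ _ → refl)) (+-identityʳ _)
sumFin-δ {suc n} c (suc j) = sumFin-δ (c ∘ suc) j

sumFin-δ′ : ∀ {n} (c : Fin n → ℕ) j → sumFin (λ i → does (j ≟ i) ⊙ c i) ≡ c j
sumFin-δ′ {suc n} c zero    = trans (cong (c zero +_) (sumFin-zero {n} λ _ → refl)) (+-identityʳ _)
sumFin-δ′ {suc n} c (suc j) = sumFin-δ′ (c ∘ suc) j

count≡sumFin : ∀ {n} (p : Fin n → Bool) → count p ≡ sumFin (𝟙 ∘ p)
count≡sumFin {zero}  p = refl
count≡sumFin {suc n} p = cong (𝟙 (p zero) +_) (count≡sumFin (p ∘ suc))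

sumFin-guard-const : ∀ {n} c (p : Fin n → Bool) → sumFin (λ a → p a ⊙ c) ≡ c * count p
sumFin-guard-const c p =
  trans (sumFin-cong pointwise) (trans (sumFin-*ˡ c (𝟙 ∘ p)) (cong (c *_) (sym (count≡sumFin p))))
  where
  pointwise : ∀ a → p a ⊙ c ≡ c * 𝟙 (p a)
  pointwise a with p a
  ... | true  = sym (*-identityʳ c)
  ... | false = sym (*-zeroʳ c)

sumFin-guard-𝟙 : ∀ {n} c (p q : Fin n → Bool) →
                 sumFin (λ a → p a ⊙ (c * 𝟙 (q a))) ≡ c * count (λ a → p a ∧ q a)
sumFin-guard-𝟙 c p q = trans (sumFin-cong pointwise) (sumFin-guard-const c (λ a → p a ∧ q a))
  where
  pointwise : ∀ a → p a ⊙ (c * 𝟙 (q a)) ≡ (p a ∧ q a) ⊙ c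
  pointwise a with p a | q a
  ... | true  | true  = *-identityʳ c
  ... | true  | false = *-zeroʳ c
  ... | false | _     = refl

sumFin-positive : ∀ {n} (f : Fin n → ℕ) → 1 ≤ sumFin f → ∃[ i ] 1 ≤ f i
sumFin-positive {suc n} f h with f zero in eq
... | suc _ = zero , subst (1 ≤_) (sym eq) (s≤s z≤n)
... | zero  = let i , p = sumFin-positive (f ∘ suc) h in suc i , p

sumFin≤1 : ∀ {n} (f : Fin n → ℕ) → (∀ i → f i ≤ 1) →
           (∀ i j → 1 ≤ f i → 1 ≤ f j → i ≡ j) → sumFin f ≤ 1
sumFin≤1 {zero}  f ≤1 unique = z≤n
sumFin≤1 {suc n} f ≤1 unique with f zero in eq
... | zero  = sumFin≤1 (f ∘ suc) (≤1 ∘ suc) (λ i j p q → Finₚ.suc-injective (unique _ _ p q))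
... | suc k = begin
  suc k + sumFin (f ∘ suc)  ≡⟨ cong (suc k +_) restZero ⟩
  suc k + 0                 ≡⟨ +-identityʳ _ ⟩
  suc k                     ≡⟨ eq ⟨
  f zero                    ≤⟨ ≤1 zero ⟩
  1                         ∎
  where
  open ≤-Reasoning
  f0>0 : 1 ≤ f zero
  f0>0 = subst (1 ≤_) (sym eq) (s≤s z≤n)
  restZero : sumFin (f ∘ suc) ≡ 0
  restZero = sumFin-zero λ i → n≤0⇒n≡0 (≮⇒≥ λ fi>0 → contradiction (unique zero (suc i) f0>0 fi>0) λ ())

sumFin-nested≤1 : ∀ {m k} (g : Fin m → Fin k → ℕ) → (∀ a → sumFin (g a) ≤ 1) →
                  (∀ a a' b b' → 1 ≤ g a b → 1 ≤ g a' b' → a ≡ a') →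
                  sumFin (λ a → sumFin (g a)) ≤ 1
sumFin-nested≤1 g ≤1 unique = sumFin≤1 (λ a → sumFin (g a)) ≤1 unique′
  where
  unique′ : ∀ a a' → 1 ≤ sumFin (g a) → 1 ≤ sumFin (g a') → a ≡ a'
  unique′ a a' p p' =
    let b , q = sumFin-positive (g a) p ; b' , q' = sumFin-positive (g a') p' in unique a a' b b' q q'

⊙-distrib-sumFin : ∀ {n} b (f : Fin n → ℕ) → b ⊙ sumFin f ≡ sumFin (λ i → b ⊙ f i)
⊙-distrib-sumFin true  f = refl
⊙-distrib-sumFin {n} false f = sym (sumFin-zero {n} λ _ → refl)

⊙*-distrib-sumFin : ∀ {n} b k (f : Fin n → ℕ) → b ⊙ (k * sumFin f) ≡ sumFin (λ i → b ⊙ (k * f i))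
⊙*-distrib-sumFin b k f = trans (cong (b ⊙_) (sym (sumFin-*ˡ k f))) (⊙-distrib-sumFin b (λ i → k * f i))

sumFin² : ∀ {n} → (Fin n × Fin n → ℕ) → ℕ
sumFin² f = sumFin (λ a → sumFin (λ b → f (a , b)))

sumFin²-cong : ∀ {n} {f g : Fin n × Fin n → ℕ} → (∀ d → f d ≡ g d) → sumFin² f ≡ sumFin² g
sumFin²-cong e = sumFin-cong (λ a → sumFin-cong (λ b → e (a , b)))

sumFin²-mono : ∀ {n} {f g : Fin n × Fin n → ℕ} → (∀ d → f d ≤ g d) → sumFin² f ≤ sumFin² g
sumFin²-mono e = sumFin-mono (λ a → sumFin-mono (λ b → e (a , b)))

sumFin²-distrib-+ : ∀ {n} (f g : Fin n × Fin n → ℕ) →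
                    sumFin² (λ d → f d + g d) ≡ sumFin² f + sumFin² g
sumFin²-distrib-+ f g =
  trans (sumFin-cong (λ a → sumFin-distrib-+ (λ b → f (a , b)) (λ b → g (a , b))))
        (sumFin-distrib-+ (λ a → sumFin (λ b → f (a , b))) (λ a → sumFin (λ b → g (a , b))))

sumFin²-*ˡ : ∀ {n} c (f : Fin n × Fin n → ℕ) → sumFin² (λ d → c * f d) ≡ c * sumFin² f
sumFin²-*ˡ c f = trans (sumFin-cong (λ a → sumFin-*ˡ c (λ b → f (a , b))))
                       (sumFin-*ˡ c (λ a → sumFin (λ b → f (a , b))))

sumFin²-sumFin-comm : ∀ {n k} (f : Fin n × Fin n → Fin k → ℕ) →
                      sumFin² (λ d → sumFin (f d)) ≡ sumFin (λ i → sumFin² (λ d → f d i))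
sumFin²-sumFin-comm f =
  trans (sumFin-cong (λ a → sumFin-comm (λ b → f (a , b))))
        (sumFin-comm (λ a i → sumFin (λ b → f (a , b) i)))

sumFin²-comm : ∀ {n} (f : Fin n × Fin n → Fin n × Fin n → ℕ) →
               sumFin² (λ d → sumFin² (f d)) ≡ sumFin² (λ e → sumFin² (λ d → f d e))
sumFin²-comm f =
  trans (sumFin²-sumFin-comm (λ d a → sumFin (λ b → f d (a , b))))
        (sumFin-cong (λ a → sumFin²-sumFin-comm (λ d b → f d (a , b))))

⊙*-distrib-sumFin² : ∀ {n} b k (f : Fin n × Fin n → ℕ) →
                     b ⊙ (k * sumFin² f) ≡ sumFin² (λ d → b ⊙ (k * f d))
⊙*-distrib-sumFin² b k f =
  trans (⊙*-distrib-sumFin b k (λ a → sumFin (λ b → f (a , b))))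
        (sumFin-cong (λ a → ⊙*-distrib-sumFin b k (λ b → f (a , b))))

_≟²_ : ∀ {n} → DecidableEquality (Fin n × Fin n)
(a , b) ≟² (c , e) = map′ (uncurry (cong₂ _,_)) ,-injective (a ≟ c ×-dec b ≟ e)

sumFin²-δ : ∀ {n} (c : Fin n × Fin n → ℕ) e → sumFin² (λ d → does (d ≟² e) ⊙ c d) ≡ c e
sumFin²-δ c (e₁ , e₂) = begin
  sumFin (λ a → sumFin (λ b → does ((a , b) ≟² (e₁ , e₂)) ⊙ c (a , b)))
    ≡⟨ sumFin-cong (λ a → trans (sumFin-cong (split a))
                               (sym (⊙-distrib-sumFin (does (a ≟ e₁)) (λ b → does (b ≟ e₂) ⊙ c (a , b))))) ⟩
  sumFin (λ a → does (a ≟ e₁) ⊙ sumFin (λ b → does (b ≟ e₂) ⊙ c (a , b)))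
    ≡⟨ sumFin-cong (λ a → cong (does (a ≟ e₁) ⊙_) (sumFin-δ (λ b → c (a , b)) e₂)) ⟩
  sumFin (λ a → does (a ≟ e₁) ⊙ c (a , e₂))
    ≡⟨ sumFin-δ (λ a → c (a , e₂)) e₁ ⟩
  c (e₁ , e₂) ∎
  where
  open ≡-Reasoning
  split : ∀ a b → does ((a , b) ≟² (e₁ , e₂)) ⊙ c (a , b) ≡ does (a ≟ e₁) ⊙ does (b ≟ e₂) ⊙ c (a , b)
  split a b with does (a ≟ e₁)
  ... | true  = refl
  ... | false = refl

count-other : ∀ {n} (p : Fin n → Bool) u → 2 ≤ count p → ∃[ z ] (p z ≡ true × z ≢ u)
count-other p u 2≤count =
  let z , pz = sumFin-positive others (+-cancelʳ-≤ 1 1 _ (≤-trans 2≤count count≤))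
      pz≡true , z≉u = ∧-true (𝟙-positive pz)
  in z , pz≡true , λ z≡u → contradiction (trans (sym z≉u) (cong not (dec-true (z ≟ u) z≡u))) λ ()
  where
  others : _ → ℕ
  others z = 𝟙 (p z ∧ not (does (z ≟ u)))
  split : ∀ z → 𝟙 (p z) ≤ others z + does (z ≟ u) ⊙ 1
  split z with p z | does (z ≟ u)
  ... | true  | true  = s≤s z≤n
  ... | true  | false = s≤s z≤n
  ... | false | _     = z≤n
  count≤ : count p ≤ sumFin others + 1
  count≤ = begin
    count p                                          ≡⟨ count≡sumFin p ⟩
    sumFin (𝟙 ∘ p)                                   ≤⟨ sumFin-mono split ⟩
    sumFin (λ z → others z + does (z ≟ u) ⊙ 1)       ≡⟨ sumFin-distrib-+ others _ ⟩
    sumFin others + sumFin (λ z → does (z ≟ u) ⊙ 1)  ≡⟨ cong (sumFin others +_) (sumFin-δ (λ _ → 1) u) ⟩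
    sumFin others + 1                                ∎
    where open ≤-Reasoning

module _ {n : ℕ} (G : SimpleGraph n) where

  adj-split : ∀ a b → 𝟙 (adj G a b)
                      ≡ 𝟙 ((suc (toℕ a) ≤ᵇ toℕ b) ∧ adj G a b) + 𝟙 ((suc (toℕ b) ≤ᵇ toℕ a) ∧ adj G b a)
  adj-split a b with <-cmp (toℕ a) (toℕ b)
  ... | tri< a<b _ _ rewrite ≤ᵇ-complete a<b | ≤ᵇ-false-complete {suc (toℕ b)} (s≤s (<⇒≤ a<b)) = sym (+-identityʳ _)
  ... | tri> _ _ b<a rewrite ≤ᵇ-complete b<a | ≤ᵇ-false-complete {suc (toℕ a)} (s≤s (<⇒≤ b<a)) | adj-sym G b a = refl
  ... | tri≈ _ a≡b _ with Finₚ.toℕ-injective a≡b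
  ... | refl rewrite ≤ᵇ-false-complete {suc (toℕ a)} (n<1+n (toℕ a)) | irrefl G a = refl

  handshake : sumFin² (𝟙 ∘ uncurry (adj G)) ≡ 2 * edgeCount G
  handshake = begin
    sumFin² (𝟙 ∘ uncurry (adj G))
      ≡⟨ sumFin-cong (λ a → trans (sumFin-cong (adj-split a)) (sumFin-distrib-+ (forward a) (backward a))) ⟩
    sumFin (λ a → sumFin (forward a) + sumFin (backward a))
      ≡⟨ sumFin-distrib-+ (sumFin ∘ forward) (sumFin ∘ backward) ⟩
    sumFin (sumFin ∘ forward) + sumFin (sumFin ∘ backward)
      ≡⟨ cong (sumFin (sumFin ∘ forward) +_) (sumFin-comm (λ a b → backward b a)) ⟨
    sumFin (sumFin ∘ forward) + sumFin (sumFin ∘ forward)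
      ≡⟨ cong₂ _+_ edges (trans edges (sym (+-identityʳ _))) ⟩
    2 * edgeCount G ∎
    where
    open ≡-Reasoning
    forward backward : Fin n → Fin n → ℕ
    forward  a b = 𝟙 ((suc (toℕ a) ≤ᵇ toℕ b) ∧ adj G a b)
    backward a b = forward b a
    edges : sumFin (sumFin ∘ forward) ≡ edgeCount G
    edges = sumFin-cong (λ a → sym (count≡sumFin (λ b → (suc (toℕ a) ≤ᵇ toℕ b) ∧ adj G a b)))

  isolatedCount-zero : (∀ v → 1 ≤ degree G v) → isolatedCount G ≡ 0
  isolatedCount-zero deg≥1 = trans (count≡sumFin (λ v → degree G v ≡ᵇ 0)) (sumFin-zero noIsolated)
    where
    noIsolated : ∀ v → 𝟙 (degree G v ≡ᵇ 0) ≡ 0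
    noIsolated v with degree G v | deg≥1 v
    ... | suc _ | _ = refl

count-∧≤ : ∀ {n} (p q : Fin n → Bool) → count (λ w → p w ∧ q w) ≤ count p
count-∧≤ p q = begin
  count (λ w → p w ∧ q w)      ≡⟨ count≡sumFin (λ w → p w ∧ q w) ⟩
  sumFin (λ w → 𝟙 (p w ∧ q w)) ≤⟨ sumFin-mono pointwise ⟩
  sumFin (𝟙 ∘ p)               ≡⟨ count≡sumFin p ⟨
  count p                      ∎
  where
  open ≤-Reasoning
  pointwise : ∀ w → 𝟙 (p w ∧ q w) ≤ 𝟙 (p w)
  pointwise w with p w
  ... | true  = 𝟙≤1 (q w)
  ... | false = z≤n

allFin-true : ∀ {n} (p : Fin n → Bool) → (∀ i → p i ≡ true) → allFin p ≡ true
allFin-true {zero}  p h = refl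
allFin-true {suc n} p h rewrite h zero = allFin-true (p ∘ suc) (h ∘ suc)

-- Vertex 0 is the least vertex of its own component.
componentCount-positive : ∀ {m} (G : SimpleGraph (suc m)) → 1 ≤ componentCount G
componentCount-positive {m} G
  rewrite allFin-true (λ u → if reach G (suc m) zero u then true else true) (λ u → if-same (reach G (suc m) zero u) true)
  = s≤s z≤n

-- Rotation systems and their faces

iter-+ : ∀ {A : Set} (f : A → A) a b x → iter f (a + b) x ≡ iter f a (iter f b x)
iter-+ f zero    b x = refl
iter-+ f (suc a) b x = cong f (iter-+ f a b x)

iter-fixed : ∀ {A : Set} (f : A → A) {x} → f x ≡ x → ∀ k → iter f k x ≡ x
iter-fixed f e zero    = refl
iter-fixed f e (suc k) = trans (cong f (iter-fixed f e k)) e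

iter-periodic : ∀ {A : Set} (f : A → A) {p x} → iter f p x ≡ x → ∀ q → iter f (q * p) x ≡ x
iter-periodic f         e zero    = refl
iter-periodic f {p} {x} e (suc q) =
  trans (iter-+ f p (q * p) x) (trans (cong (iter f p) (iter-periodic f e q)) e)

iter-mod : ∀ {A : Set} (f : A → A) {p x} → iter f (suc p) x ≡ x →
           ∀ k → iter f k x ≡ iter f (k % suc p) x
iter-mod f {p} {x} e k =
  trans (cong (λ t → iter f t x) (m≡m%n+[m/n]*n k (suc p)))
        (trans (iter-+ f (k % suc p) _ x) (cong (iter f (k % suc p)) (iter-periodic f e (k / suc p))))

allBelow-sound : ∀ m (p : ℕ → Bool) → allBelow m p ≡ true → ∀ k → k < m → p k ≡ true
allBelow-sound (suc m) p h k k<1+m with ∧-true {allBelow m p} h | m≤n⇒m<n∨m≡n (s≤s⁻¹ k<1+m)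
... | below , _   | inj₁ k<m = allBelow-sound m p below k k<m
... | _     , top | inj₂ refl = top

module Embedding {n : ℕ} (G : SimpleGraph n) (rot : Fin n → Fin n → Fin n)
                  (isRot : IsRotationSystem G rot) where
  open IsRotationSystem isRot public
  open Faces G rot public

  rot-closed : ∀ {h y} → adj G h y ≡ true → ∀ k → adj G h (iter (rot h) k y) ≡ true
  rot-closed hy zero    = hy
  rot-closed hy (suc k) = closed _ _ (rot-closed hy k)

  rot-surjective : ∀ {h v} → adj G h v ≡ true → ∃[ x ] (adj G h x ≡ true × rot h x ≡ v)
  rot-surjective {h} {v} hv with cyclic h (rot h v) v (closed h v hv) hv
  ... | zero  , fixed = v , hv , fixed
  ... | suc k , reach = iter (rot h) k (rot h v) , rot-closed (closed h v hv) k , reach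

  rot-preimages : ∀ v b → sumFin (λ a → 𝟙 (adj G v a ∧ does (rot v a ≟ b))) ≡ 𝟙 (adj G v b)
  rot-preimages v b with adj G v b in vb
  ... | false = sumFin-zero none
    where
    none : ∀ a → 𝟙 (adj G v a ∧ does (rot v a ≟ b)) ≡ 0
    none a with adj G v a in va | rot v a ≟ b
    ... | false | _        = refl
    ... | true  | no _     = refl
    ... | true  | yes refl = contradiction (trans (sym (closed v a va)) vb) λ ()
  ... | true with rot-surjective vb
  ... | x , vx , x↦b = ≤-antisym (sumFin≤1 _ (λ a → 𝟙≤1 _) unique)
                                 (≤-trans (≤-reflexive (sym hit)) (≤-sumFin (λ a → 𝟙 (adj G v a ∧ does (rot v a ≟ b))) x))
    where
    hit : 𝟙 (adj G v x ∧ does (rot v x ≟ b)) ≡ 1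
    hit rewrite vx | dec-true (rot v x ≟ b) x↦b = refl
    unique : ∀ a a' → 1 ≤ 𝟙 (adj G v a ∧ does (rot v a ≟ b)) → 1 ≤ 𝟙 (adj G v a' ∧ does (rot v a' ≟ b)) →
             a ≡ a'
    unique a a' p p' with ∧-true (𝟙-positive p) | ∧-true (𝟙-positive p')
    ... | va , a↦b | va' , a'↦b =
      inj v a a' va va' (trans (does-sound (rot v a ≟ b) a↦b) (sym (does-sound (rot v a' ≟ b) a'↦b)))

  -- rot v permutes the neighbours of v.
  rotation-reindex : ∀ v (F : Fin n → ℕ) → sumFin (λ a → adj G v a ⊙ F (rot v a)) ≡ sumFin (λ a → adj G v a ⊙ F a)
  rotation-reindex v F = begin
    sumFin (λ a → adj G v a ⊙ F (rot v a))
      ≡⟨ sumFin-cong (λ a → trans (cong (adj G v a ⊙_) (sym (sumFin-δ′ F (rot v a))))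
                                  (⊙-distrib-sumFin (adj G v a) (λ b → does (rot v a ≟ b) ⊙ F b))) ⟩
    sumFin (λ a → sumFin (λ b → adj G v a ⊙ does (rot v a ≟ b) ⊙ F b))
      ≡⟨ sumFin-comm (λ a b → adj G v a ⊙ does (rot v a ≟ b) ⊙ F b) ⟩
    sumFin (λ b → sumFin (λ a → adj G v a ⊙ does (rot v a ≟ b) ⊙ F b))
      ≡⟨ sumFin-cong (λ b → trans (sumFin-cong (λ a → guard a b))
                                  (sumFin-*ˡ (F b) (λ a → 𝟙 (adj G v a ∧ does (rot v a ≟ b))))) ⟩
    sumFin (λ b → F b * sumFin (λ a → 𝟙 (adj G v a ∧ does (rot v a ≟ b))))
      ≡⟨ sumFin-cong (λ b → trans (cong (F b *_) (rot-preimages v b)) (unguard b)) ⟩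
    sumFin (λ a → adj G v a ⊙ F a) ∎
    where
    open ≡-Reasoning
    guard : ∀ a b → adj G v a ⊙ does (rot v a ≟ b) ⊙ F b ≡ F b * 𝟙 (adj G v a ∧ does (rot v a ≟ b))
    guard a b with adj G v a | does (rot v a ≟ b)
    ... | true  | true  = sym (*-identityʳ (F b))
    ... | true  | false = sym (*-zeroʳ (F b))
    ... | false | _     = sym (*-zeroʳ (F b))
    unguard : ∀ b → F b * 𝟙 (adj G v b) ≡ adj G v b ⊙ F b
    unguard b with adj G v b
    ... | true  = *-identityʳ (F b)
    ... | false = *-zeroʳ (F b)

  isDart : Fin n × Fin n → Bool
  isDart = uncurry (adj G)

  Dart : Fin n × Fin n → Set
  Dart d = isDart d ≡ true

  φ-dart : ∀ {d} → Dart d → Dart (φ d)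
  φ-dart {u , v} uv = closed v u (trans (adj-sym G v u) uv)

  iterφ-dart : ∀ k {d} → Dart d → Dart (iter φ k d)
  iterφ-dart zero    h = h
  iterφ-dart (suc k) h = φ-dart (iterφ-dart k h)

  φ-injective : ∀ {d d'} → Dart d → Dart d' → φ d ≡ φ d' → d ≡ d'
  φ-injective {u , v} {u' , v'} uv u'v' e with cong proj₁ e
  ... | refl = cong (_, v) (inj v u u' (trans (adj-sym G v u) uv) (trans (adj-sym G v u') u'v') (cong proj₂ e))

  iterφ-injective : ∀ k {d d'} → Dart d → Dart d' → iter φ k d ≡ iter φ k d' → d ≡ d'
  iterφ-injective zero    h h' e = e
  iterφ-injective (suc k) h h' e =
    iterφ-injective k h h' (φ-injective (iterφ-dart k h) (iterφ-dart k h') e)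

  code-injective : ∀ {d d'} → code d ≡ code d' → d ≡ d'
  code-injective {u , v} {u' , v'} e =
    uncurry (cong₂ _,_) (Finₚ.combine-injective u v u' v' (Finₚ.toℕ-injective (begin
      toℕ (combine u v)   ≡⟨ Finₚ.toℕ-combine u v ⟩
      n * toℕ u + toℕ v   ≡⟨ cong (_+ toℕ v) (*-comm n (toℕ u)) ⟩
      code (u , v)        ≡⟨ e ⟩
      code (u' , v')      ≡⟨ cong (_+ toℕ v') (*-comm (toℕ u') n) ⟩
      n * toℕ u' + toℕ v' ≡⟨ Finₚ.toℕ-combine u' v' ⟨
      toℕ (combine u' v') ∎)))
    where open ≡-Reasoning

  φ-period : ∀ {d} → Dart d → ∃[ p ] (1 ≤ p × p ≤ n * n × iter φ p d ≡ d)
  φ-period {d} h with Finₚ.pigeonhole (n<1+n (n * n)) (λ k → uncurry combine (iter φ (toℕ k) d))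
  ... | i , j , i<j , same = p , m<n⇒0<n∸m i<j , ≤-trans (m∸n≤m (toℕ j) (toℕ i)) (s≤s⁻¹ (Finₚ.toℕ<n j)) ,
                             iterφ-injective (toℕ i) (iterφ-dart p h) h iᵗʰ≡
    where
    p = toℕ j ∸ toℕ i
    iᵗʰ≡ : iter φ (toℕ i) (iter φ p d) ≡ iter φ (toℕ i) d
    iᵗʰ≡ = begin
      iter φ (toℕ i) (iter φ p d) ≡⟨ iter-+ φ (toℕ i) p d ⟨
      iter φ (toℕ i + p) d        ≡⟨ cong (λ k → iter φ k d) (m+[n∸m]≡n (<⇒≤ i<j)) ⟩
      iter φ (toℕ j) d            ≡⟨ uncurry (cong₂ _,_) (Finₚ.combine-injective _ _ _ _ same) ⟨
      iter φ (toℕ i) d            ∎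
      where open ≡-Reasoning

  faceRep-minimal : ∀ {d} → Dart d → isFaceRep d ≡ true → ∀ k → code d ≤ code (iter φ k d)
  faceRep-minimal {d} h rep k with φ-period h
  ... | suc p , _ , p≤n² , period =
    subst (λ e → code d ≤ code e) (sym (iter-mod φ period k))
          (≤ᵇ-sound (allBelow-sound (n * n) _ rep (k % suc p) (<-≤-trans (m%n<n k (suc p)) p≤n²)))

  faceRep-unique : ∀ {r r'} → Dart r → Dart r' → isFaceRep r ≡ true → isFaceRep r' ≡ true →
                   ∀ t → iter φ t r' ≡ r → r ≡ r'
  faceRep-unique {r} {r'} h h' rep rep' t e with φ-period h'
  ... | suc p , _ , _ , period = code-injective (≤-antisym (subst (λ x → code r ≤ code x) back (faceRep-minimal h rep (t * p)))
                                                           (subst (λ x → code r' ≤ code x) e (faceRep-minimal h' rep' t)))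
    where
    back : iter φ (t * p) r ≡ r'
    back = begin
      iter φ (t * p) r               ≡⟨ cong (iter φ (t * p)) e ⟨
      iter φ (t * p) (iter φ t r')   ≡⟨ iter-+ φ (t * p) t r' ⟨
      iter φ (t * p + t) r'          ≡⟨ cong (λ x → iter φ x r') (trans (+-comm (t * p) t) (sym (*-suc t p))) ⟩
      iter φ (t * suc p) r'          ≡⟨ iter-periodic φ period t ⟩
      r'                             ∎
      where open ≡-Reasoning

  isTriangle : Fin n × Fin n → Bool
  isTriangle d = does (iter φ 3 d ≟² d)

  isTriangle-sound : ∀ {d} → isTriangle d ≡ true → iter φ 3 d ≡ d
  isTriangle-sound {d} = does-sound (iter φ 3 d ≟² d)

  isTriangle-sound-¬ : ∀ {d} → isTriangle d ≡ false → iter φ 3 d ≢ d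
  isTriangle-sound-¬ {d} = does-sound-¬ (iter φ 3 d ≟² d)

  isTriangle-φ : ∀ {d} → Dart d → isTriangle (φ d) ≡ isTriangle d
  isTriangle-φ {d} h with isTriangle d in e | isTriangle (φ d) in e'
  ... | true  | true  = refl
  ... | false | false = refl
  ... | true  | false = contradiction (cong φ (isTriangle-sound e)) (isTriangle-sound-¬ e')
  ... | false | true  = contradiction (φ-injective (iterφ-dart 3 h) h (isTriangle-sound e')) (isTriangle-sound-¬ e)

  isTriangle-iterφ : ∀ k {d} → Dart d → isTriangle (iter φ k d) ≡ isTriangle d
  isTriangle-iterφ zero    h = refl
  isTriangle-iterφ (suc k) h = trans (isTriangle-φ (iterφ-dart k h)) (isTriangle-iterφ k h)

  triangle-corner : ∀ {h v} → Dart (h , v) → isTriangle (h , v) ≡ true →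
                    rot (rot v h) v ≡ h × rot h (rot v h) ≡ v × adj G h (rot v h) ≡ true
  triangle-corner {h} {v} hv t = rot-b-v≡h , rot-h-b≡v , adj-hb
    where
    b = rot v h
    φ³≡ : (rot b v , rot (rot b v) b) ≡ (h , v)
    φ³≡ = isTriangle-sound t
    rot-b-v≡h : rot b v ≡ h
    rot-b-v≡h = cong proj₁ φ³≡
    rot-h-b≡v : rot h b ≡ v
    rot-h-b≡v = trans (cong (λ y → rot y b) (sym rot-b-v≡h)) (cong proj₂ φ³≡)
    adj-hb : adj G h b ≡ true
    adj-hb = trans (adj-sym G h b) (subst (λ y → adj G b y ≡ true) rot-b-v≡h (iterφ-dart 2 hv))

  vertexShare faceShare : Fin n × Fin n → ℕ
  vertexShare d = if isTriangle d then 4 else 6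
  faceShare   d = if isTriangle d then 8 else 6

  vertexTotal faceTotal : ℕ
  vertexTotal = sumFin² (λ d → isDart d ⊙ vertexShare d)
  faceTotal   = sumFin² (λ d → isDart d ⊙ faceShare d)

  shares-total : vertexTotal + faceTotal ≡ 24 * edgeCount G
  shares-total = begin
    vertexTotal + faceTotal
      ≡⟨ sumFin²-distrib-+ (λ d → isDart d ⊙ vertexShare d) (λ d → isDart d ⊙ faceShare d) ⟨
    sumFin² (λ d → isDart d ⊙ vertexShare d + isDart d ⊙ faceShare d)
      ≡⟨ sumFin²-cong twelve ⟩
    sumFin² (λ d → 12 * 𝟙 (isDart d))
      ≡⟨ sumFin²-*ˡ 12 (𝟙 ∘ isDart) ⟩
    12 * sumFin² (𝟙 ∘ isDart)
      ≡⟨ cong (12 *_) (handshake G) ⟩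
    12 * (2 * edgeCount G)
      ≡⟨ *-assoc 12 2 (edgeCount G) ⟨
    24 * edgeCount G ∎
    where
    open ≡-Reasoning
    twelve : ∀ d → isDart d ⊙ vertexShare d + isDart d ⊙ faceShare d ≡ 12 * 𝟙 (isDart d)
    twelve d with isDart d | isTriangle d
    ... | true  | true  = refl
    ... | true  | false = refl
    ... | false | _     = refl

  -- Every face is a triangle or has at least four darts; we count 3 resp. 4 of them.
  countedLength : Fin n × Fin n → ℕ
  countedLength d = if isTriangle d then 3 else 4

  φ-no-fixpoint : ∀ {d} → Dart d → φ d ≢ d
  φ-no-fixpoint {u , v} uv e with cong proj₁ e
  ... | refl = contradiction (trans (sym uv) (irrefl G u)) λ ()

  module _ (deg≥2 : ∀ v → 2 ≤ degree G v) where

    -- φ² (u , v) = (u , v) would make u a fixed point of the cyclic permutation rot v.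
    φ²-no-fixpoint : ∀ {d} → Dart d → iter φ 2 d ≢ d
    φ²-no-fixpoint {u , v} uv e with count-other (adj G v) u (deg≥2 v)
    ... | z , vz , z≢u with cyclic v u z (trans (adj-sym G v u) uv) vz
    ... | k , u↦z = z≢u (trans (sym u↦z) (iter-fixed (rot v) (cong proj₁ e) k))

    short-iterates-distinct : ∀ {d} → Dart d → ∀ t → 1 ≤ t → t < countedLength d → iter φ t d ≢ d
    short-iterates-distinct h 1 _ _ = φ-no-fixpoint h
    short-iterates-distinct h 2 _ _ = φ²-no-fixpoint h
    short-iterates-distinct {d} h 3 _ t<len with isTriangle d in e
    short-iterates-distinct h 3 _ (s≤s (s≤s (s≤s ()))) | true
    ... | false = isTriangle-sound-¬ e
    short-iterates-distinct {d} h (suc (suc (suc (suc t)))) _ t<len with isTriangle d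
    short-iterates-distinct h (suc (suc (suc (suc t)))) _ (s≤s (s≤s (s≤s ()))) | true
    short-iterates-distinct h (suc (suc (suc (suc t)))) _ (s≤s (s≤s (s≤s (s≤s ())))) | false

    counted-dart-unique≤ : ∀ {r r'} → Dart r → Dart r' → isFaceRep r ≡ true → isFaceRep r' ≡ true →
                           ∀ {i j} → i ≤ j → j < countedLength r' →
                           iter φ i r ≡ iter φ j r' → r ≡ r' × i ≡ j
    counted-dart-unique≤ {r} {r'} h h' rep rep' {i} {j} i≤j j<len e = r≡r' , i≡j
      where
      t = j ∸ i
      r≡φᵗr' : iter φ t r' ≡ r
      r≡φᵗr' = sym (iterφ-injective i h (iterφ-dart t h')
                 (trans e (trans (cong (λ k → iter φ k r') (sym (m+[n∸m]≡n i≤j))) (iter-+ φ i t r'))))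
      r≡r' : r ≡ r'
      r≡r' = faceRep-unique h h' rep rep' t r≡φᵗr'
      t≡0 : t ≡ 0
      t≡0 with t in t≡
      ... | zero  = refl
      ... | suc s = contradiction (trans (subst (λ k → iter φ k r' ≡ r) t≡ r≡φᵗr') r≡r')
                      (short-iterates-distinct h' (suc s) (s≤s z≤n)
                        (≤-<-trans (≤-trans (≤-reflexive (sym t≡)) (m∸n≤m j i)) j<len))
      i≡j : i ≡ j
      i≡j = sym (trans (sym (m+[n∸m]≡n i≤j)) (trans (cong (i +_) t≡0) (+-identityʳ i)))

    counted-dart-unique : ∀ {r r'} → Dart r → Dart r' → isFaceRep r ≡ true → isFaceRep r' ≡ true →
                          ∀ {i j} → i < countedLength r → j < countedLength r' →
                          iter φ i r ≡ iter φ j r' → r ≡ r' × i ≡ j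
    counted-dart-unique h h' rep rep' {i} {j} i<len j<len e with ≤-total i j
    ... | inj₁ i≤j = counted-dart-unique≤ h h' rep rep' i≤j j<len e
    ... | inj₂ j≤i with counted-dart-unique≤ h' h rep' rep j≤i i<len (sym e)
    ... | r'≡r , j≡i = sym r'≡r , sym j≡i

    counted : Fin n × Fin n → Fin 4 → Bool
    counted r i = isDart r ∧ isFaceRep r ∧ (suc (toℕ i) ≤ᵇ countedLength r)

    occurs : Fin n × Fin n → Fin n × Fin n → Fin 4 → ℕ
    occurs d r i = 𝟙 (counted r i ∧ does (d ≟² iter φ (toℕ i) r))

    occurs-sound : ∀ d {r i} → 1 ≤ occurs d r i →
                   Dart r × isFaceRep r ≡ true × toℕ i < countedLength r × d ≡ iter φ (toℕ i) r
    occurs-sound d {r} {i} o with ∧-true (𝟙-positive o)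
    ... | c , same with ∧-true {isDart r} c
    ... | h , c′ with ∧-true {isFaceRep r} c′
    ... | rep , i<len = h , rep , ≤ᵇ-sound i<len , does-sound (d ≟² iter φ (toℕ i) r) same

    occurs-unique : ∀ d {r r' i i'} → 1 ≤ occurs d r i → 1 ≤ occurs d r' i' → r ≡ r' × i ≡ i'
    occurs-unique d o o' with occurs-sound d o | occurs-sound d o'
    ... | h , rep , i<len , e | h' , rep' , i'<len , e'
      with counted-dart-unique h h' rep rep' i<len i'<len (trans (sym e) e')
    ... | r≡r' , i≡i' = r≡r' , Finₚ.toℕ-injective i≡i'

    multiplicity : Fin n × Fin n → ℕ
    multiplicity d = sumFin² (λ r → sumFin (occurs d r))

    multiplicity≤1 : ∀ d → multiplicity d ≤ 1
    multiplicity≤1 d = sumFin-nested≤1 (λ a b → sumFin (occurs d (a , b))) row≤1 sameRow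
      where
      cell≤1 : ∀ a b → sumFin (occurs d (a , b)) ≤ 1
      cell≤1 a b = sumFin≤1 (occurs d (a , b)) (λ i → 𝟙≤1 _) (λ i i' o o' → proj₂ (occurs-unique d o o'))
      row≤1 : ∀ a → sumFin (λ b → sumFin (occurs d (a , b))) ≤ 1
      row≤1 a = sumFin-nested≤1 (λ b → occurs d (a , b)) (cell≤1 a)
                  (λ b b' i i' o o' → cong proj₂ (proj₁ (occurs-unique d o o')))
      sameRow : ∀ a a' b b' → 1 ≤ sumFin (occurs d (a , b)) → 1 ≤ sumFin (occurs d (a' , b')) → a ≡ a'
      sameRow a a' b b' o o' with sumFin-positive (occurs d (a , b)) o | sumFin-positive (occurs d (a' , b')) o'
      ... | i , oi | i' , oi' = cong proj₁ (proj₁ (occurs-unique d oi oi'))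

    counted-share : ∀ r i → counted r i ⊙ isDart (iter φ (toℕ i) r) ⊙ faceShare (iter φ (toℕ i) r)
                            ≡ counted r i ⊙ faceShare r
    counted-share r i with counted r i in c
    ... | false = refl
    ... | true with ∧-true {isDart r} c
    ... | h , _ rewrite iterφ-dart (toℕ i) h | isTriangle-iterφ (toℕ i) h = refl

    share-occurrences : ∀ r i → sumFin² (λ d → isDart d ⊙ (faceShare d * occurs d r i)) ≡ counted r i ⊙ faceShare r
    share-occurrences r i =
      trans (sumFin²-cong (λ d → ⊙-𝟙-∧ (isDart d) (counted r i) (does (d ≟² iter φ (toℕ i) r)) (faceShare d)))
            (trans (sumFin²-δ (λ d → counted r i ⊙ isDart d ⊙ faceShare d) (iter φ (toℕ i) r))
                   (counted-share r i))

    counted-total : ∀ r → sumFin (λ i → counted r i ⊙ faceShare r) ≡ 24 * 𝟙 (isDart r ∧ isFaceRep r)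
    counted-total r with isDart r | isFaceRep r | isTriangle r
    ... | true  | true  | true  = refl
    ... | true  | true  | false = refl
    ... | true  | false | _     = refl
    ... | false | _     | _     = refl

    -- Each face receives 3 · 8 or at least 4 · 6 from the faceShares of its darts.
    faceCount-bound : 24 * faceCount ≤ faceTotal
    faceCount-bound = begin
      24 * faceCount
        ≡⟨ cong (24 *_) (sumFin-cong (λ u → count≡sumFin (λ v → adj G u v ∧ isFaceRep (u , v)))) ⟩
      24 * sumFin² (λ r → 𝟙 (isDart r ∧ isFaceRep r))
        ≡⟨ sumFin²-*ˡ 24 (λ r → 𝟙 (isDart r ∧ isFaceRep r)) ⟨
      sumFin² (λ r → 24 * 𝟙 (isDart r ∧ isFaceRep r))
        ≡⟨ sumFin²-cong (λ r → trans (sym (counted-total r)) (sym (sumFin-cong (λ i → share-occurrences r i)))) ⟩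
      sumFin² (λ r → sumFin (λ i → sumFin² (λ d → isDart d ⊙ (faceShare d * occurs d r i))))
        ≡⟨ sumFin²-cong (λ r → sumFin²-sumFin-comm (λ d i → isDart d ⊙ (faceShare d * occurs d r i))) ⟨
      sumFin² (λ r → sumFin² (λ d → sumFin (λ i → isDart d ⊙ (faceShare d * occurs d r i))))
        ≡⟨ sumFin²-comm (λ r d → sumFin (λ i → isDart d ⊙ (faceShare d * occurs d r i))) ⟩
      sumFin² (λ d → sumFin² (λ r → sumFin (λ i → isDart d ⊙ (faceShare d * occurs d r i))))
        ≡⟨ sumFin²-cong (λ d → distribute d) ⟨
      sumFin² (λ d → isDart d ⊙ (faceShare d * multiplicity d))
        ≤⟨ sumFin²-mono (λ d → ⊙-monoʳ (isDart d) (≤-trans (*-monoʳ-≤ (faceShare d) (multiplicity≤1 d))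
                                                            (≤-reflexive (*-identityʳ _)))) ⟩
      faceTotal ∎
      where
      open ≤-Reasoning
      distribute : ∀ d → isDart d ⊙ (faceShare d * multiplicity d)
                         ≡ sumFin² (λ r → sumFin (λ i → isDart d ⊙ (faceShare d * occurs d r i)))
      distribute d = trans (⊙*-distrib-sumFin² (isDart d) (faceShare d) (λ r → sumFin (occurs d r)))
                           (sumFin²-cong (λ r → ⊙*-distrib-sumFin (isDart d) (faceShare d) (occurs d r)))

-- Euler's formula

euler-bound : ∀ {m} (G : SimpleGraph (suc m)) {rot} → IsPlanarRotation G rot →
              (∀ v → 1 ≤ degree G v) → 2 + edgeCount G ≤ suc m + Faces.faceCount G rot
euler-bound {m} G {rot} planar deg≥1 = begin
  2 + edgeCount G                             ≤⟨ +-monoˡ-≤ (edgeCount G) (*-monoʳ-≤ 2 (componentCount-positive G)) ⟩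
  2 * componentCount G + edgeCount G          ≡⟨ planar ⟨
  suc m + faceCount + isolatedCount G         ≡⟨ cong (suc m + faceCount +_) (isolatedCount-zero G deg≥1) ⟩
  suc m + faceCount + 0                       ≡⟨ +-identityʳ _ ⟩
  suc m + faceCount                           ∎
  where
  open ≤-Reasoning
  open Faces G rot

vertexTotal-upper : ∀ {m} (G : SimpleGraph (suc m)) {rot} (isRot : IsRotationSystem G rot) →
                     IsPlanarRotation G rot → (∀ v → 2 ≤ degree G v) →
                     48 + Embedding.vertexTotal G rot isRot ≤ 24 * suc m
vertexTotal-upper {m} G {rot} isRot planar deg≥2 =
  +-cancelʳ-≤ faceTotal _ _ (begin
    48 + vertexTotal + faceTotal      ≡⟨ +-assoc 48 vertexTotal faceTotal ⟩
    48 + (vertexTotal + faceTotal)    ≡⟨ cong (48 +_) (shares-total) ⟩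
    48 + 24 * edgeCount G             ≡⟨ *-distribˡ-+ 24 2 (edgeCount G) ⟨
    24 * (2 + edgeCount G)            ≤⟨ *-monoʳ-≤ 24 (euler-bound G planar (λ v → ≤-trans (s≤s z≤n) (deg≥2 v))) ⟩
    24 * (suc m + faceCount)          ≡⟨ *-distribˡ-+ 24 (suc m) faceCount ⟩
    24 * suc m + 24 * faceCount       ≤⟨ +-monoʳ-≤ (24 * suc m) (faceCount-bound deg≥2) ⟩
    24 * suc m + faceTotal            ∎)
  where
  open ≤-Reasoning
  open Embedding G rot isRot

-- Discharging

module Discharging {n : ℕ} (G : SimpleGraph n) (rot : Fin n → Fin n → Fin n)
                   (isRot : IsRotationSystem G rot)
                   (enoughHeavy : ∀ v → degree G v ≤ 5 →
                                  3 ≤ count (λ w → adj G v w ∧ (12 ≤ᵇ degree G w))) where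
  open Embedding G rot isRot

  light heavy : Fin n → Bool
  light x = degree G x ≤ᵇ 5
  heavy x = 12 ≤ᵇ degree G x

  heavy⇒¬light : ∀ {x} → heavy x ≡ true → light x ≡ false
  heavy⇒¬light {x} h =
    ≤ᵇ-false-complete {m = degree G x} (≤-trans (from-yes (6 ≤? 12)) (≤ᵇ-sound {n = degree G x} h))

  light⇒¬heavy : ∀ {x} → light x ≡ true → heavy x ≡ false
  light⇒¬heavy {x} l =
    ≤ᵇ-false-complete {n = degree G x} (≤-trans (s≤s (≤ᵇ-sound {m = degree G x} l)) (from-yes (6 ≤? 12)))

  deg≥3 : ∀ v → 3 ≤ degree G v
  deg≥3 v with degree G v ≤? 5
  ... | yes d≤5 = ≤-trans (enoughHeavy v d≤5) (count-∧≤ (adj G v) heavy)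
  ... | no  d≰5 = ≤-trans (from-yes (3 ≤? 6)) (≰⇒> d≰5)

  portion : Bool → ℕ
  portion otherLight = if otherLight then 1 else 2

  -- A heavy vertex h passes two units through each corner (x , h , rot h x) to its light
  -- endpoints, split evenly when both are light.
  cornerOut : Fin n → Fin n → ℕ
  cornerOut h x = light x ⊙ portion (light (rot h x)) + light (rot h x) ⊙ portion (light x)

  cornerTransfer : Fin n → Fin n → Fin n → ℕ
  cornerTransfer h x v = adj G h x ⊙ heavy h ⊙
    (does (x ≟ v) ⊙ light x ⊙ portion (light (rot h x)) + does (rot h x ≟ v) ⊙ light (rot h x) ⊙ portion (light x))

  sent received charge : Fin n → ℕ
  sent h     = sumFin (λ x → sumFin (cornerTransfer h x))
  received v = sumFin (λ h → sumFin (λ x → cornerTransfer h x v))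
  charge v   = sumFin (λ a → adj G a v ⊙ vertexShare (a , v))

  transfer-conserved : sumFin sent ≡ sumFin received
  transfer-conserved = trans (sumFin-cong (λ h → sumFin-comm (cornerTransfer h)))
                             (sumFin-comm (λ h v → sumFin (λ x → cornerTransfer h x v)))

  charge-total : sumFin charge ≡ vertexTotal
  charge-total = sumFin-comm (λ v a → adj G a v ⊙ vertexShare (a , v))

  corner-sent : ∀ h x → sumFin (cornerTransfer h x) ≡ adj G h x ⊙ heavy h ⊙ cornerOut h x
  corner-sent h x with adj G h x | heavy h
  ... | true  | true  = trans (sumFin-distrib-+ (λ v → does (x ≟ v) ⊙ first) (λ v → does (rot h x ≟ v) ⊙ second))
                             (cong₂ _+_ (sumFin-δ′ (λ _ → first) x) (sumFin-δ′ (λ _ → second) (rot h x)))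
    where
    first  = light x ⊙ portion (light (rot h x))
    second = light (rot h x) ⊙ portion (light x)
  ... | true  | false = sumFin-zero {n} (λ _ → refl)
  ... | false | _     = sumFin-zero {n} (λ _ → refl)

  portions≤2 : ∀ l l' → l ⊙ portion l' + l' ⊙ portion l ≤ 2
  portions≤2 true  true  = ≤-refl
  portions≤2 true  false = ≤-refl
  portions≤2 false true  = ≤-refl
  portions≤2 false false = z≤n

  sent≤ : ∀ h → sent h ≤ heavy h ⊙ (2 * degree G h)
  sent≤ h = begin
    sent h                                             ≡⟨ sumFin-cong (corner-sent h) ⟩
    sumFin (λ x → adj G h x ⊙ heavy h ⊙ cornerOut h x) ≤⟨ sumFin-mono corner≤ ⟩
    sumFin (λ x → heavy h ⊙ (2 * 𝟙 (adj G h x)))       ≡⟨ ⊙*-distrib-sumFin (heavy h) 2 (𝟙 ∘ adj G h) ⟨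
    heavy h ⊙ (2 * sumFin (𝟙 ∘ adj G h))               ≡⟨ cong (λ k → heavy h ⊙ (2 * k)) (count≡sumFin (adj G h)) ⟨
    heavy h ⊙ (2 * degree G h)                         ∎
    where
    open ≤-Reasoning
    corner≤ : ∀ x → adj G h x ⊙ heavy h ⊙ cornerOut h x ≤ heavy h ⊙ (2 * 𝟙 (adj G h x))
    corner≤ x with adj G h x | heavy h
    ... | true  | true  = portions≤2 (light x) (light (rot h x))
    ... | true  | false = z≤n
    ... | false | true  = z≤n
    ... | false | false = z≤n

  charge≥ : ∀ v → 4 * degree G v ≤ charge v
  charge≥ v = begin
    4 * degree G v                   ≡⟨ cong (4 *_) (count≡sumFin (adj G v)) ⟩
    4 * sumFin (𝟙 ∘ adj G v)         ≡⟨ sumFin-*ˡ 4 (𝟙 ∘ adj G v) ⟨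
    sumFin (λ a → 4 * 𝟙 (adj G v a)) ≤⟨ sumFin-mono corner≥ ⟩
    charge v                         ∎
    where
    open ≤-Reasoning
    corner≥ : ∀ a → 4 * 𝟙 (adj G v a) ≤ adj G a v ⊙ vertexShare (a , v)
    corner≥ a rewrite adj-sym G a v with adj G v a | isTriangle (a , v)
    ... | true  | true  = ≤-refl
    ... | true  | false = from-yes (4 ≤? 6)
    ... | false | _     = z≤n

  nonlight-bound : ∀ v → light v ≡ false → 24 + sent v ≤ charge v
  nonlight-bound v nonlight = ≤-trans (+-monoʳ-≤ 24 (sent≤ v)) (≤-trans arithmetic (charge≥ v))
    where
    d = degree G v
    arithmetic : 24 + heavy v ⊙ (2 * d) ≤ 4 * d
    arithmetic with heavy v in isHeavy
    ... | true  = begin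
      24 + 2 * d        ≤⟨ +-monoˡ-≤ (2 * d) (*-monoʳ-≤ 2 (≤ᵇ-sound {n = d} isHeavy)) ⟩
      2 * d + 2 * d     ≡⟨ *-distribʳ-+ d 2 2 ⟨
      4 * d             ∎
      where open ≤-Reasoning
    ... | false = ≤-trans (≤-reflexive (+-identityʳ 24)) (*-monoʳ-≤ 4 (≤ᵇ-false-sound {m = d} nonlight))

  portion≥1 : ∀ l → 1 ≤ portion l
  portion≥1 true  = ≤-refl
  portion≥1 false = s≤s z≤n

  -- A lower bound for what a light v receives through the corner of its heavy neighbour h
  -- that precedes v in the rotation at h.
  guaranteed : Fin n → Fin n → ℕ
  guaranteed v h = if isTriangle (h , v) then portion (light (rot v h)) else 1

  viaPreceding : Fin n → Fin n → Fin n → ℕ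
  viaPreceding v h x = adj G h x ⊙ heavy h ⊙ does (rot h x ≟ v) ⊙ light (rot h x) ⊙ portion (light x)

  received-from : ∀ v h → sumFin (λ x → cornerTransfer h x v)
                          ≡ adj G h v ⊙ heavy h ⊙ light v ⊙ portion (light (rot h v)) + sumFin (viaPreceding v h)
  received-from v h = begin
    sumFin (λ x → cornerTransfer h x v)
      ≡⟨ sumFin-cong split ⟩
    sumFin (λ x → does (x ≟ v) ⊙ viaOwn x + viaPreceding v h x)
      ≡⟨ sumFin-distrib-+ (λ x → does (x ≟ v) ⊙ viaOwn x) (viaPreceding v h) ⟩
    sumFin (λ x → does (x ≟ v) ⊙ viaOwn x) + sumFin (viaPreceding v h)
      ≡⟨ cong (_+ sumFin (viaPreceding v h)) (sumFin-δ viaOwn v) ⟩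
    viaOwn v + sumFin (viaPreceding v h) ∎
    where
    open ≡-Reasoning
    viaOwn : Fin n → ℕ
    viaOwn x = adj G h x ⊙ heavy h ⊙ light x ⊙ portion (light (rot h x))
    split : ∀ x → cornerTransfer h x v ≡ does (x ≟ v) ⊙ viaOwn x + viaPreceding v h x
    split x = trans (cong (adj G h x ⊙_) (⊙-distrib-+ (heavy h) _ _))
                (trans (⊙-distrib-+ (adj G h x) _ _)
                  (cong (_+ viaPreceding v h x)
                    (trans (cong (adj G h x ⊙_) (⊙-comm (heavy h) (does (x ≟ v)) _))
                           (⊙-comm (adj G h x) (does (x ≟ v)) _))))

  preceding-neighbour : ∀ {v h} → adj G h v ≡ true →
                        ∃[ x ] (adj G h x ≡ true × rot h x ≡ v × guaranteed v h ≤ portion (light x))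
  preceding-neighbour {v} {h} hv with isTriangle (h , v) in t
  ... | true  = let _ , rot-h-b≡v , h~b = triangle-corner hv t in rot v h , h~b , rot-h-b≡v , ≤-refl
  ... | false = let x , hx , x↦v = rot-surjective hv in x , hx , x↦v , portion≥1 (light x)

  preceding-corner : ∀ {v} h → light v ≡ true →
                     adj G v h ⊙ heavy h ⊙ guaranteed v h ≤ sumFin (viaPreceding v h)
  preceding-corner {v} h lv with adj G v h in vh
  ... | false = z≤n
  ... | true  with preceding-neighbour (trans (adj-sym G h v) vh)
  ... | x , hx , x↦v , g≤ =
    ≤-trans (⊙-monoʳ (heavy h) g≤) (≤-trans (≤-reflexive (sym at-x)) (≤-sumFin (viaPreceding v h) x))
    where
    at-x : viaPreceding v h x ≡ heavy h ⊙ portion (light x)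
    at-x rewrite hx | dec-true (rot h x ≟ v) x↦v | x↦v | lv = refl

  received≥ : ∀ v → light v ≡ true →
              sumFin (λ h → adj G v h ⊙ heavy h ⊙ portion (light (rot h v)))
              + sumFin (λ h → adj G v h ⊙ heavy h ⊙ guaranteed v h) ≤ received v
  received≥ v lv = begin
    sumFin viaOwn + sumFin viaPred
      ≡⟨ sumFin-distrib-+ viaOwn viaPred ⟨
    sumFin (λ h → viaOwn h + viaPred h)
      ≤⟨ sumFin-mono (λ h → +-mono-≤ (≤-reflexive (viaOwn≡ h)) (preceding-corner h lv)) ⟩
    sumFin (λ h → adj G h v ⊙ heavy h ⊙ light v ⊙ portion (light (rot h v)) + sumFin (viaPreceding v h))
      ≡⟨ sumFin-cong (λ h → received-from v h) ⟨
    received v ∎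
    where
    open ≤-Reasoning
    viaOwn viaPred : Fin n → ℕ
    viaOwn  h = adj G v h ⊙ heavy h ⊙ portion (light (rot h v))
    viaPred h = adj G v h ⊙ heavy h ⊙ guaranteed v h
    viaOwn≡ : ∀ h → viaOwn h ≡ adj G h v ⊙ heavy h ⊙ light v ⊙ portion (light (rot h v))
    viaOwn≡ h rewrite adj-sym G h v | lv = refl

  -- The share of the final charge of a light v attributable to its corner (a , v , rot v a).
  cornerGain : Fin n → Fin n → ℕ
  cornerGain v a = vertexShare (a , v) + heavy (rot v a) ⊙ portion (light (rot (rot v a) v)) + heavy a ⊙ guaranteed v a

  cornerGains≤ : ∀ v → light v ≡ true → sumFin (λ a → adj G v a ⊙ cornerGain v a) ≤ charge v + received v
  cornerGains≤ v lv = begin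
    sumFin (λ a → adj G v a ⊙ cornerGain v a)
      ≡⟨ sumFin-cong split ⟩
    sumFin (λ a → own a + viaNext a + viaPrev a)
      ≡⟨ sumFin-distrib-+ (λ a → own a + viaNext a) viaPrev ⟩
    sumFin (λ a → own a + viaNext a) + sumFin viaPrev
      ≡⟨ cong (_+ sumFin viaPrev) (sumFin-distrib-+ own viaNext) ⟩
    sumFin own + sumFin viaNext + sumFin viaPrev
      ≡⟨ cong₂ (λ c r → c + r + sumFin viaPrev) ownTotal (rotation-reindex v F) ⟩
    charge v + sumFin (λ a → adj G v a ⊙ F a) + sumFin viaPrev
      ≡⟨ +-assoc (charge v) _ _ ⟩
    charge v + (sumFin (λ a → adj G v a ⊙ F a) + sumFin viaPrev)
      ≤⟨ +-monoʳ-≤ (charge v) (received≥ v lv) ⟩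
    charge v + received v ∎
    where
    open ≤-Reasoning
    F : Fin n → ℕ
    F b = heavy b ⊙ portion (light (rot b v))
    own viaNext viaPrev : Fin n → ℕ
    own     a = adj G v a ⊙ vertexShare (a , v)
    viaNext a = adj G v a ⊙ F (rot v a)
    viaPrev a = adj G v a ⊙ heavy a ⊙ guaranteed v a
    ownTotal : sumFin own ≡ charge v
    ownTotal = sumFin-cong (λ a → cong (_⊙ vertexShare (a , v)) (adj-sym G v a))
    split : ∀ a → adj G v a ⊙ cornerGain v a ≡ own a + viaNext a + viaPrev a
    split a with adj G v a
    ... | true  = refl
    ... | false = refl

  triangle-gain : ∀ ha hb la lb → (ha ≡ true → la ≡ false) → (hb ≡ true → lb ≡ false) →
                  2 + 3 * 𝟙 ha + 3 * 𝟙 hb ≤ 4 + hb ⊙ portion la + ha ⊙ portion lb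
  triangle-gain true  true  la    lb    ha⇒ hb⇒ rewrite ha⇒ refl | hb⇒ refl = ≤-refl
  triangle-gain true  false la    lb    _   _  = +-monoʳ-≤ 4 (portion≥1 lb)
  triangle-gain false true  la    lb    _   _  = ≤-trans (+-monoʳ-≤ 4 (portion≥1 la)) (m≤m+n _ 0)
  triangle-gain false false la    lb    _   _  = from-yes (2 ≤? 4)

  other-gain : ∀ ha hb p → 1 ≤ p → 2 + 3 * 𝟙 ha + 3 * 𝟙 hb ≤ 6 + hb ⊙ p + ha ⊙ 1
  other-gain true  true  p 1≤p = +-monoʳ-≤ 6 (+-monoˡ-≤ 1 1≤p)
  other-gain true  false p _   = from-yes (5 ≤? 7)
  other-gain false true  p _   = ≤-trans (from-yes (5 ≤? 6)) (m≤m+n 6 _)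
  other-gain false false p _   = from-yes (2 ≤? 6)

  cornerGain≥ : ∀ {v a} → adj G v a ≡ true →
                2 + 3 * 𝟙 (heavy a) + 3 * 𝟙 (heavy (rot v a)) ≤ cornerGain v a
  cornerGain≥ {v} {a} va with isTriangle (a , v) in t
  ... | true  rewrite proj₁ (triangle-corner (trans (adj-sym G a v) va) t) =
    triangle-gain (heavy a) (heavy (rot v a)) (light a) (light (rot v a)) heavy⇒¬light heavy⇒¬light
  ... | false = other-gain (heavy a) (heavy (rot v a)) (portion (light (rot (rot v a) v))) (portion≥1 _)

  cornerGains≥24 : ∀ v → light v ≡ true → 24 ≤ sumFin (λ a → adj G v a ⊙ cornerGain v a)
  cornerGains≥24 v lv = begin
    24
      ≤⟨ arithmetic ⟩
    2 * d + 3 * k + 3 * k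
      ≡⟨ cong₂ (λ x y → x + y + 3 * k) twos heavyHere ⟨
    sumFin two + sumFin heavyHere′ + 3 * k
      ≡⟨ cong (sumFin two + sumFin heavyHere′ +_) heavyNext ⟨
    sumFin two + sumFin heavyHere′ + sumFin heavyNext′
      ≡⟨ cong (_+ sumFin heavyNext′) (sumFin-distrib-+ two heavyHere′) ⟨
    sumFin (λ a → two a + heavyHere′ a) + sumFin heavyNext′
      ≡⟨ sumFin-distrib-+ (λ a → two a + heavyHere′ a) heavyNext′ ⟨
    sumFin (λ a → two a + heavyHere′ a + heavyNext′ a)
      ≤⟨ sumFin-mono guarded ⟩
    sumFin (λ a → adj G v a ⊙ cornerGain v a) ∎
    where
    open ≤-Reasoning
    d = degree G v
    k = count (λ a → adj G v a ∧ heavy a)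
    k≥3 : 3 ≤ k
    k≥3 = enoughHeavy v (≤ᵇ-sound {n = 5} lv)
    arithmetic : 24 ≤ 2 * d + 3 * k + 3 * k
    arithmetic = +-mono-≤ (+-mono-≤ (*-monoʳ-≤ 2 (≤-trans k≥3 (count-∧≤ (adj G v) heavy))) (*-monoʳ-≤ 3 k≥3))
                          (*-monoʳ-≤ 3 k≥3)
    two heavyHere′ heavyNext′ : Fin n → ℕ
    two        a = adj G v a ⊙ 2
    heavyHere′ a = adj G v a ⊙ (3 * 𝟙 (heavy a))
    heavyNext′ a = adj G v a ⊙ (3 * 𝟙 (heavy (rot v a)))
    twos : sumFin two ≡ 2 * d
    twos = sumFin-guard-const 2 (adj G v)
    heavyHere : sumFin heavyHere′ ≡ 3 * k
    heavyHere = sumFin-guard-𝟙 3 (adj G v) heavy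
    heavyNext : sumFin heavyNext′ ≡ 3 * k
    heavyNext = trans (rotation-reindex v (λ b → 3 * 𝟙 (heavy b))) heavyHere
    guarded : ∀ a → two a + heavyHere′ a + heavyNext′ a ≤ adj G v a ⊙ cornerGain v a
    guarded a with adj G v a in va
    ... | true  = cornerGain≥ va
    ... | false = z≤n

  vertex-bound : ∀ v → 24 + sent v ≤ charge v + received v
  vertex-bound v = bound (light v) refl
    where
    bound : ∀ b → light v ≡ b → 24 + sent v ≤ charge v + received v
    bound false nonlight = ≤-trans (nonlight-bound v nonlight) (m≤m+n _ _)
    bound true  lv       = begin
      24 + sent v                               ≤⟨ +-monoʳ-≤ 24 (sent≤ v) ⟩
      24 + heavy v ⊙ (2 * degree G v)           ≡⟨ cong (λ b → 24 + b ⊙ (2 * degree G v)) (light⇒¬heavy lv) ⟩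
      24 + 0                                    ≤⟨ cornerGains≥24 v lv ⟩
      sumFin (λ a → adj G v a ⊙ cornerGain v a) ≤⟨ cornerGains≤ v lv ⟩
      charge v + received v                     ∎
      where open ≤-Reasoning

  vertexTotal-lower : 24 * n ≤ vertexTotal
  vertexTotal-lower = +-cancelʳ-≤ (sumFin sent) _ _ (begin
    24 * n + sumFin sent                     ≡⟨ cong (_+ sumFin sent) (trans (*-comm 24 n) (sym (sumFin-const {n} 24))) ⟩
    sumFin {n} (λ _ → 24) + sumFin sent      ≡⟨ sumFin-distrib-+ (λ _ → 24) sent ⟨
    sumFin (λ v → 24 + sent v)               ≤⟨ sumFin-mono vertex-bound ⟩
    sumFin (λ v → charge v + received v)     ≡⟨ sumFin-distrib-+ charge received ⟩
    sumFin charge + sumFin received          ≡⟨ cong₂ _+_ charge-total (sym transfer-conserved) ⟩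
    vertexTotal + sumFin sent                ∎)
    where open ≤-Reasoning

lemma6p4 : (m : ℕ) (G : SimpleGraph (suc m)) → Planar G →
    ∃[ v ] (degree G v ≤ 5 ×
            count (λ w → adj G v w ∧ (12 ≤ᵇ degree G w)) ≤ 2)
lemma6p4 m G (rot , isRot , planar)
  with Finₚ.any? (λ v → degree G v ≤? 5 ×-dec count (λ w → adj G v w ∧ (12 ≤ᵇ degree G w)) ≤? 2)
... | yes found = found
... | no  none  = contradiction (≤-trans (+-monoʳ-≤ 48 vertexTotal-lower) (vertexTotal-upper G isRot planar deg≥2))
                                (m+n≮n 47 (24 * suc m))
  where
  enoughHeavy : ∀ v → degree G v ≤ 5 → 3 ≤ count (λ w → adj G v w ∧ (12 ≤ᵇ degree G w))
  enoughHeavy v d≤5 = ≰⇒> (λ fewHeavy → none (v , d≤5 , fewHeavy))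
  open Discharging G rot isRot enoughHeavy
  deg≥2 : ∀ v → 2 ≤ degree G v
  deg≥2 v = ≤-trans (n≤1+n 2) (deg≥3 v)
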